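{- Let $n$ be a positive integer, $G=D_{8n}=\langle a,b\mid a^{4n}=b^2=1,\ bab=a^{ -1}\rangle$, $A=\langle a^{2n},b\rangle\cong C_2\times C_2$ and $H=\langle b\rangle\cong C_2$. Then: (a) for each $g\in G$, the left coset $gA$ contains an element $x$ such that $x^2\in y^{ -1}Hy$ for some $y\in A$; (b) $A$ is not a perfect code of the pair $(G,H)$.
   Context: Graphs are finite, undirected and simple; a subset $C$ of the vertex set $V$ of a graph is a perfect code if every vertex in $V\setminus C$ is adjacent to exactly one vertex of $C$. For a group $G$, $H\leq G$ and an inverse-closed subset $U\subseteq G\setminus H$, the coset graph $\mathrm{Cos}(G,H,U)$ has vertices the left cosets of $H$ in $G$, with $xH$, $yH$ adjacent iff $x^{ -1}y\in HUH$. A subgroup $A$ with $H\leq A\leq G$ is a perfect code of the pair $(G,H)$ if for some such $U$ the set of left cosets of $H$ contained in $A$ is a perfect code in $\mathrm{Cos}(G,H,U)$. -}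

module Defs where

open import Data.Nat using (ℕ; zero; suc; _+_; _*_; _∸_; NonZero)
open import Data.Nat.Properties using (m*n≢0)
open import Data.Nat.DivMod using (_mod_)
open import Data.Fin using (Fin; toℕ)
open import Data.Bool using (Bool; true; false; _xor_)
open import Data.Product using (Σ; ∃; ∃-syntax; _×_; _,_)
open import Data.Sum using (_⊎_)
open import Relation.Nullary using (¬_)
open import Relation.Binary.PropositionalEquality using (_≡_)

-- G is given by its carrier, multiplication and inversion; subgroups
-- H ≤ A ≤ G are given by membership predicates; the connection set U
-- is a (decidable) subset of G, i.e. a Bool-valued predicate.

module CosetGraph {G : Set} (_∙_ : G → G → G) (_⁻¹ : G → G)
                  (H : G → Set) where

  _∈U_ : G → (G → Bool) → Set
  u ∈U U = U u ≡ true

  Admissible : (G → Bool) → Set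
  Admissible U = (∀ u → u ∈U U → (u ⁻¹) ∈U U) × (∀ u → u ∈U U → ¬ H u)

  InHUH : (G → Bool) → G → Set
  InHUH U z = ∃[ h₁ ] ∃[ u ] ∃[ h₂ ] (H h₁ × u ∈U U × H h₂ × z ≡ (h₁ ∙ u) ∙ h₂)

  -- vertices of Cos(G,H,U) are left cosets xH, represented by x;
  -- xH = yH iff x⁻¹y ∈ H
  SameCoset : G → G → Set
  SameCoset x y = H ((x ⁻¹) ∙ y)

  Adjacent : (G → Bool) → G → G → Set
  Adjacent U x y = InHUH U ((x ⁻¹) ∙ y)

  -- a set C of vertices (given by a predicate on representatives,
  -- invariant under SameCoset) is a perfect code of Cos(G,H,U):
  -- every vertex outside C is adjacent to exactly one vertex of C
  IsPerfectCode : (G → Bool) → (G → Set) → Set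
  IsPerfectCode U C =
    ∀ x → ¬ C x →
      (∃[ c ] (C c × Adjacent U x c)) ×
      (∀ c c' → C c → C c' → Adjacent U x c → Adjacent U x c' → SameCoset c c')

  CosetIn : (G → Set) → G → Set
  CosetIn A x = ∀ h → H h → A (x ∙ h)

  IsPerfectCodeOfPair : (G → Set) → Set
  IsPerfectCodeOfPair A =
    ∃[ U ] (Admissible U × IsPerfectCode U (CosetIn A))

-- The dihedral group D_{8n} = ⟨ a , b ∣ a^{4n} = b² = 1 , bab = a⁻¹ ⟩
-- of order 8n, in normal form: the pair (i , e) stands for a^i b^e,
-- with i ∈ ℤ/4n and e ∈ {0,1} (false = 0, true = 1).

module Dihedral (n : ℕ) .{{_ : NonZero n}} where

  N : ℕ
  N = 4 * n

  instance
    N≢0 : NonZero N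
    N≢0 = m*n≢0 4 n

  record D : Set where
    constructor ⟨_,_⟩
    field
      expo : Fin N
      bexp : Bool
  open D public

  addF : Fin N → Fin N → Fin N
  addF i j = (toℕ i + toℕ j) mod N

  negF : Fin N → Fin N
  negF i = (N ∸ toℕ i) mod N

  -- b^e a^j = a^{(-1)^e j} b^e
  twist : Bool → Fin N → Fin N
  twist false j = j
  twist true  j = negF j

  -- (a^i b^e)(a^j b^f) = a^{i + (-1)^e j} b^{e + f}
  _∙_ : D → D → D
  ⟨ i , e ⟩ ∙ ⟨ j , f ⟩ = ⟨ addF i (twist e j) , e xor f ⟩

  _⁻¹ : D → D
  ⟨ i , false ⟩ ⁻¹ = ⟨ negF i , false ⟩
  ⟨ i , true  ⟩ ⁻¹ = ⟨ i , true ⟩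

  A : D → Set
  A x = (toℕ (expo x) ≡ 0) ⊎ (toℕ (expo x) ≡ 2 * n)

  H : D → Set
  H x = toℕ (expo x) ≡ 0

  open CosetGraph _∙_ _⁻¹ H public

{-# OPTIONS --safe #-}
module Submission where

-- In D₈ₙ every coset gA contains a reflection aⁱb, and reflections square to 1.
-- For (b): a double coset HuH = {a^{±j}, a^{±j}b} depends only on the exponent j
-- of u up to sign, so whether a^k b^e lies in HUH depends only on ±k.  For both
-- vertices H and a²ⁿH inside A the element a⁻ⁿc has exponent ±n, so the vertex
-- aⁿH outside A is adjacent to both of them or to neither.

open import Defs
open import Data.Nat using (ℕ; NonZero; suc; _+_; _*_; _∸_; _<_; _%_; z≤n; z<s; s≤s)
open import Data.Nat.Properties
  using (+-identityʳ; m∸n≤m; *-monoˡ-<; m+n∸m≡n; m+[n∸m]≡n; m∸[m∸n]≡n; m<n⇒0<n∸m; m<m+n; <⇒≤; <⇒≢)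
open import Data.Nat.DivMod using (n%n≡0; m<n⇒m%n≡m; [m+n]%n≡m%n)
open import Data.Nat.Tactic.RingSolver using (solve-∀)
open import Data.Fin as Fin using (toℕ; fromℕ<)
open import Data.Fin.Properties using (toℕ-injective; toℕ<n; toℕ-fromℕ<)
open import Data.Bool using (Bool; true; false; not; _xor_)
open import Data.Bool.Properties using (xor-assoc; xor-same; xor-identityʳ)
open import Data.Product using (∃-syntax; _×_; _,_)
open import Data.Sum using (inj₁; inj₂)
open import Function using (_∘_)
open import Relation.Nullary using (¬_)
open import Relation.Binary.PropositionalEquality
open ≡-Reasoning

module _ (m : ℕ) where
  open Dihedral (suc m)

  toℕ-addF : ∀ i j → toℕ (addF i j) ≡ (toℕ i + toℕ j) % N
  toℕ-addF i j = toℕ-fromℕ< _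

  toℕ-negF : ∀ i → toℕ (negF i) ≡ (N ∸ toℕ i) % N
  toℕ-negF i = toℕ-fromℕ< _

  addF-identityˡ : ∀ j → addF Fin.zero j ≡ j
  addF-identityˡ j = toℕ-injective (trans (toℕ-addF Fin.zero j) (m<n⇒m%n≡m (toℕ<n j)))

  addF-identityʳ : ∀ i → addF i Fin.zero ≡ i
  addF-identityʳ i = toℕ-injective (begin
    toℕ (addF i Fin.zero) ≡⟨ toℕ-addF i Fin.zero ⟩
    (toℕ i + 0) % N       ≡⟨ cong (_% N) (+-identityʳ (toℕ i)) ⟩
    toℕ i % N             ≡⟨ m<n⇒m%n≡m (toℕ<n i) ⟩
    toℕ i                 ∎)

  negF-zero : negF Fin.zero ≡ Fin.zero
  negF-zero = toℕ-injective (trans (toℕ-negF Fin.zero) (n%n≡0 N))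

  toℕ-negF-pos : ∀ i → 0 < toℕ i → toℕ (negF i) ≡ N ∸ toℕ i
  toℕ-negF-pos (Fin.suc j) _ = trans (toℕ-negF (Fin.suc j)) (m<n⇒m%n≡m (s≤s (m∸n≤m _ (toℕ j))))

  addF-inverseʳ : ∀ i → addF i (negF i) ≡ Fin.zero
  addF-inverseʳ Fin.zero = trans (cong (addF Fin.zero) negF-zero) (addF-identityʳ Fin.zero)
  addF-inverseʳ i@(Fin.suc _) = toℕ-injective (begin
    toℕ (addF i (negF i))        ≡⟨ toℕ-addF i (negF i) ⟩
    (toℕ i + toℕ (negF i)) % N   ≡⟨ cong (λ t → (toℕ i + t) % N) (toℕ-negF-pos i z<s) ⟩
    (toℕ i + (N ∸ toℕ i)) % N    ≡⟨ cong (_% N) (m+[n∸m]≡n (<⇒≤ (toℕ<n i))) ⟩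
    N % N                        ≡⟨ n%n≡0 N ⟩
    0                            ∎)

  negF-involutive : ∀ i → negF (negF i) ≡ i
  negF-involutive Fin.zero = trans (cong negF negF-zero) negF-zero
  negF-involutive i@(Fin.suc _) = toℕ-injective (begin
    toℕ (negF (negF i))  ≡⟨ toℕ-negF-pos (negF i) 0<-i ⟩
    N ∸ toℕ (negF i)     ≡⟨ cong (N ∸_) -i≡N∸i ⟩
    N ∸ (N ∸ toℕ i)      ≡⟨ m∸[m∸n]≡n (<⇒≤ (toℕ<n i)) ⟩
    toℕ i                ∎)
    where
    -i≡N∸i : toℕ (negF i) ≡ N ∸ toℕ i
    -i≡N∸i = toℕ-negF-pos i z<s
    0<-i : 0 < toℕ (negF i)
    0<-i = subst (0 <_) (sym -i≡N∸i) (m<n⇒0<n∸m (toℕ<n i))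

  twist-zero : ∀ e → twist e Fin.zero ≡ Fin.zero
  twist-zero false = refl
  twist-zero true  = negF-zero

  twist-twist : ∀ e e' j → twist e (twist e' j) ≡ twist (e xor e') j
  twist-twist false e'    j = refl
  twist-twist true  false j = refl
  twist-twist true  true  j = negF-involutive j

  twist-involutive : ∀ e j → twist e (twist e j) ≡ j
  twist-involutive e j = trans (twist-twist e e j) (cong (λ e' → twist e' j) (xor-same e))

  ε : D
  ε = ⟨ Fin.zero , false ⟩

  H⇒expo≡zero : ∀ h → H h → expo h ≡ Fin.zero
  H⇒expo≡zero h = toℕ-injective

  expo-∙H : ∀ x h → H h → expo (x ∙ h) ≡ expo x
  expo-∙H x h h∈H = begin
    addF (expo x) (twist (bexp x) (expo h))  ≡⟨ cong (addF (expo x) ∘ twist (bexp x)) (H⇒expo≡zero h h∈H) ⟩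
    addF (expo x) (twist (bexp x) Fin.zero)  ≡⟨ cong (addF (expo x)) (twist-zero (bexp x)) ⟩
    addF (expo x) Fin.zero                   ≡⟨ addF-identityʳ (expo x) ⟩
    expo x                                   ∎

  expo-H∙ : ∀ h x → H h → expo (h ∙ x) ≡ twist (bexp h) (expo x)
  expo-H∙ h x h∈H = begin
    addF (expo h) (twist (bexp h) (expo x))  ≡⟨ cong (λ i → addF i (twist (bexp h) (expo x))) (H⇒expo≡zero h h∈H) ⟩
    addF Fin.zero (twist (bexp h) (expo x))  ≡⟨ addF-identityˡ _ ⟩
    twist (bexp h) (expo x)                  ∎

  ∙-identityʳ : ∀ x → x ∙ ε ≡ x
  ∙-identityʳ x = cong₂ ⟨_,_⟩ (expo-∙H x ε refl) (xor-identityʳ (bexp x))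

  ε⁻¹≡ε : ε ⁻¹ ≡ ε
  ε⁻¹≡ε = cong (⟨_, false ⟩) negF-zero

  A⇒CosetIn : ∀ x → A x → CosetIn A x
  A⇒CosetIn x x∈A h h∈H = subst (λ i → A ⟨ i , false ⟩) (sym (expo-∙H x h h∈H)) x∈A

  CosetIn⇒A : ∀ x → CosetIn A x → A x
  CosetIn⇒A x xH⊆A = subst (λ i → A ⟨ i , false ⟩) (expo-∙H x ε refl) (xH⊆A ε refl)

  reflection-in-coset : ∀ g → g ∙ ⟨ Fin.zero , not (bexp g) ⟩ ≡ ⟨ expo g , true ⟩
  reflection-in-coset g@(⟨ _ , false ⟩) = cong (⟨_, true ⟩) (expo-∙H g ⟨ Fin.zero , true ⟩ refl)
  reflection-in-coset g@(⟨ _ , true ⟩)  = cong (⟨_, true ⟩) (expo-∙H g ε refl)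

  reflection-involutive : ∀ i → ⟨ i , true ⟩ ∙ ⟨ i , true ⟩ ≡ ε
  reflection-involutive i = cong (⟨_, false ⟩) (addF-inverseʳ i)

  module _ (U : D → Bool) where

    InHUH⇒±U : ∀ {z} → InHUH U z → ∃[ u ] (u ∈U U × ∃[ e ] expo z ≡ twist e (expo u))
    InHUH⇒±U (h₁ , u , h₂ , h₁∈H , u∈U , h₂∈H , refl) =
      u , u∈U , bexp h₁ , trans (expo-∙H (h₁ ∙ u) h₂ h₂∈H) (expo-H∙ h₁ u h₁∈H)

    ±U⇒InHUH : ∀ {w u} e → u ∈U U → expo w ≡ twist e (expo u) → InHUH U w
    ±U⇒InHUH {w} {u} e u∈U w≡±u = h₁ , u , h₂ , refl , u∈U , refl , cong₂ ⟨_,_⟩ expo≡ bexp≡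
      where
      g : Bool
      g = e xor bexp u
      h₁ h₂ : D
      h₁ = ⟨ Fin.zero , e ⟩
      h₂ = ⟨ Fin.zero , g xor bexp w ⟩
      expo≡ : expo w ≡ expo ((h₁ ∙ u) ∙ h₂)
      expo≡ = begin
        expo w                 ≡⟨ w≡±u ⟩
        twist e (expo u)       ≡⟨ expo-H∙ h₁ u refl ⟨
        expo (h₁ ∙ u)          ≡⟨ expo-∙H (h₁ ∙ u) h₂ refl ⟨
        expo ((h₁ ∙ u) ∙ h₂)   ∎
      bexp≡ : bexp w ≡ g xor (g xor bexp w)
      bexp≡ = begin
        bexp w                   ≡⟨ cong (_xor bexp w) (xor-same g) ⟨
        (g xor g) xor bexp w     ≡⟨ xor-assoc g g (bexp w) ⟩
        g xor (g xor bexp w)     ∎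

    InHUH-twist : ∀ {z w} e → InHUH U z → expo w ≡ twist e (expo z) → InHUH U w
    InHUH-twist {z} {w} e z∈HUH w≡±z with InHUH⇒±U z∈HUH
    ... | u , u∈U , e' , z≡±u = ±U⇒InHUH (e xor e') u∈U (begin
      expo w                     ≡⟨ w≡±z ⟩
      twist e (expo z)           ≡⟨ cong (twist e) z≡±u ⟩
      twist e (twist e' (expo u)) ≡⟨ twist-twist e e' (expo u) ⟩
      twist (e xor e') (expo u)  ∎)

  n<N : suc m < N
  n<N = m<m+n (suc m) z<s

  2n<N : 2 * suc m < N
  2n<N = *-monoˡ-< (suc m) {2} {4} (s≤s (s≤s (s≤s z≤n)))

  aⁿ a²ⁿ : D
  aⁿ  = ⟨ fromℕ< n<N , false ⟩
  a²ⁿ = ⟨ fromℕ< 2n<N , false ⟩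

  aⁿ∉A : ¬ A aⁿ
  aⁿ∉A (inj₁ n≡0)  with () ← trans (sym (toℕ-fromℕ< n<N)) n≡0
  aⁿ∉A (inj₂ n≡2n) = <⇒≢ (m<m+n (suc m) z<s) (trans (sym (toℕ-fromℕ< n<N)) n≡2n)

  a²ⁿ∈A : A a²ⁿ
  a²ⁿ∈A = inj₂ (toℕ-fromℕ< 2n<N)

  ε∈A : A ε
  ε∈A = inj₁ refl

  ε≁a²ⁿ : ¬ SameCoset ε a²ⁿ
  ε≁a²ⁿ ε~a²ⁿ with () ← begin
    toℕ (fromℕ< 2n<N)         ≡⟨ cong toℕ (expo-H∙ ε a²ⁿ refl) ⟨
    toℕ (expo (ε ∙ a²ⁿ))      ≡⟨ cong (λ x → toℕ (expo (x ∙ a²ⁿ))) ε⁻¹≡ε ⟨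
    toℕ (expo ((ε ⁻¹) ∙ a²ⁿ)) ≡⟨ ε~a²ⁿ ⟩
    0                         ∎

  aⁿ⁻¹∙A≡±aⁿ : ∀ c → A c → ∃[ e ] expo ((aⁿ ⁻¹) ∙ c) ≡ twist e (expo aⁿ)
  aⁿ⁻¹∙A≡±aⁿ c (inj₁ c∈H) = true , (begin
    addF (negF (expo aⁿ)) (expo c)      ≡⟨ cong (addF (negF (expo aⁿ))) (H⇒expo≡zero c c∈H) ⟩
    addF (negF (expo aⁿ)) Fin.zero      ≡⟨ addF-identityʳ _ ⟩
    negF (expo aⁿ)                      ∎)
  aⁿ⁻¹∙A≡±aⁿ c (inj₂ c≡2n) = false , toℕ-injective (begin
    toℕ (addF (negF (expo aⁿ)) (expo c))   ≡⟨ toℕ-addF (negF (expo aⁿ)) (expo c) ⟩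
    (toℕ (negF (expo aⁿ)) + toℕ (expo c)) % N
      ≡⟨ cong₂ (λ s t → (s + t) % N) (toℕ-negF-pos (expo aⁿ) (subst (0 <_) (sym n̂) z<s)) c≡2n ⟩
    (N ∸ toℕ (expo aⁿ) + 2 * n) % N       ≡⟨ cong (λ t → (N ∸ t + 2 * n) % N) n̂ ⟩
    -- N = 4 * n unfolds to n + 3 * n
    (N ∸ n + 2 * n) % N                   ≡⟨ cong (λ t → (t + 2 * n) % N) (m+n∸m≡n n (3 * n)) ⟩
    (3 * n + 2 * n) % N                   ≡⟨ cong (_% N) (3k+2k≡k+4k n) ⟩
    (n + N) % N                           ≡⟨ [m+n]%n≡m%n n N ⟩
    n % N                                 ≡⟨ m<n⇒m%n≡m n<N ⟩
    n                                     ≡⟨ n̂ ⟨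
    toℕ (expo aⁿ)                         ∎)
    where
    n : ℕ
    n = suc m
    n̂ : toℕ (expo aⁿ) ≡ n
    n̂ = toℕ-fromℕ< n<N
    3k+2k≡k+4k : ∀ k → 3 * k + 2 * k ≡ k + 4 * k
    3k+2k≡k+4k = solve-∀

  Adjacent-aⁿ-A-transfer : ∀ U {c d} → A c → A d → Adjacent U aⁿ c → Adjacent U aⁿ d
  Adjacent-aⁿ-A-transfer U {c} {d} c∈A d∈A aⁿ~c
    with e , c≡±aⁿ ← aⁿ⁻¹∙A≡±aⁿ c c∈A | f , d≡±aⁿ ← aⁿ⁻¹∙A≡±aⁿ d d∈A =
    InHUH-twist U (f xor e) aⁿ~c (begin
      expo ((aⁿ ⁻¹) ∙ d)                          ≡⟨ d≡±aⁿ ⟩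
      twist f (expo aⁿ)                           ≡⟨ cong (twist f) (twist-involutive e (expo aⁿ)) ⟨
      twist f (twist e (twist e (expo aⁿ)))       ≡⟨ twist-twist f e _ ⟩
      twist (f xor e) (twist e (expo aⁿ))         ≡⟨ cong (twist (f xor e)) c≡±aⁿ ⟨
      twist (f xor e) (expo ((aⁿ ⁻¹) ∙ c))        ∎)

  every-coset-contains-involution : ∀ g → ∃[ x ] ((∃[ k ] (A k × x ≡ g ∙ k)) ×
    (∃[ y ] ∃[ h ] (A y × H h × x ∙ x ≡ ((y ⁻¹) ∙ h) ∙ y)))
  every-coset-contains-involution g = g ∙ k , (k , inj₁ refl , refl) , ε , ε , ε∈A , refl , (begin
    (g ∙ k) ∙ (g ∙ k)                  ≡⟨ cong (λ x → x ∙ x) (reflection-in-coset g) ⟩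
    ⟨ expo g , true ⟩ ∙ ⟨ expo g , true ⟩ ≡⟨ reflection-involutive (expo g) ⟩
    ε                                  ≡⟨ ε⁻¹≡ε ⟨
    ε ⁻¹                               ≡⟨ ∙-identityʳ (ε ⁻¹) ⟨
    (ε ⁻¹) ∙ ε                         ≡⟨ ∙-identityʳ ((ε ⁻¹) ∙ ε) ⟨
    ((ε ⁻¹) ∙ ε) ∙ ε                   ∎)
    where
    k : D
    k = ⟨ Fin.zero , not (bexp g) ⟩

  A-not-perfect-code : ¬ IsPerfectCodeOfPair A
  A-not-perfect-code (U , _ , perfect) with (c , c∈C , aⁿ~c) , unique ← perfect aⁿ (aⁿ∉A ∘ CosetIn⇒A aⁿ) =
    ε≁a²ⁿ (unique ε a²ⁿ (A⇒CosetIn ε ε∈A) (A⇒CosetIn a²ⁿ a²ⁿ∈A) (aⁿ~ ε∈A) (aⁿ~ a²ⁿ∈A))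
    where
    aⁿ~ : ∀ {d} → A d → Adjacent U aⁿ d
    aⁿ~ d∈A = Adjacent-aⁿ-A-transfer U (CosetIn⇒A c c∈C) d∈A aⁿ~c

proposition3p2 : (n : ℕ) .{{_ : NonZero n}} →
    let open Dihedral n in
      (∀ (g : D) → ∃[ x ] ((∃[ k ] (A k × x ≡ g ∙ k)) ×
                           (∃[ y ] ∃[ h ] (A y × H h × x ∙ x ≡ ((y ⁻¹) ∙ h) ∙ y))))
      × ¬ IsPerfectCodeOfPair A
proposition3p2 (suc m) = every-coset-contains-involution m , A-not-perfect-code m
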